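{- Let $D$ be a diagram with column weight $\mathrm{cwt}(D)=(m_1,\dots,m_n)$, and let $M_j=\max\{m_i: j\le i\le n\}$ for $1\le j\le n$. Then for all $\tilde D\in\mathrm{Min}(D)$ and all $1\le j\le n$: (i) the cells in columns $c$ of $\tilde D$ with $j\le c\le n$ occupy rows weakly below row $M_j$; and (ii) for each $1\le\tilde r\le M_j$ there exists a column $c^*$ with $j\le c^*\le n$ and $(\tilde r,c^*)\in\tilde D$.
   Context: A diagram is a finite subset $D\subset\mathbb{Z}_{>0}\times\mathbb{Z}_{>0}$; $(r,c)\in D$ is a cell in row $r$, column $c$. If the rightmost nonempty column of $D$ is $n$, $\mathrm{cwt}(D)=(m_1,\dots,m_n)$ where $m_i$ is the number of cells in column $i$. Kohnert move at row $r$: if row $r$ is empty, $\mathcal{K}(D,r)=D$; otherwise let $(r,c)$ be the rightmost cell of row $r$; if some $r'<r$ has $(r',c)\notin D$, take the largest such $r'$ and set $\mathcal{K}(D,r)=(D\setminus\{(r,c)\})\cup\{(r',c)\}$; else $\mathcal{K}(D,r)=D$. $\mathrm{KD}(D)$ is the set of diagrams obtainable from $D$ by finite sequences of Kohnert moves, and $\mathrm{Min}(D)=\{\tilde D\in\mathrm{KD}(D):\mathcal{K}(\tilde D,r)=\tilde D\ \forall r\}$. -}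

module Defs where

open import Data.Nat using (ℕ; zero; suc; _≤_; _∸_; _⊔_; _≟_)
open import Data.Product using (_×_; _,_; proj₁; proj₂; ∃)
open import Data.Product.Properties using (≡-dec)
open import Data.List using (List; []; _∷_; map; filter; foldr; length)
open import Data.List.Membership.Propositional using (_∈_)
open import Data.Maybe using (Maybe; just; nothing)
open import Relation.Binary.PropositionalEquality using (_≡_)
open import Relation.Binary.Definitions using (DecidableEquality)
open import Relation.Nullary using (¬_; yes; no)
open import Relation.Nullary.Decidable using (¬?)
open import Relation.Binary.Construct.Closure.ReflexiveTransitive using (Star)

-- A cell (r , c) : row r, column c.  Rows are numbered from the bottom (row 1).
Cell : Set
Cell = ℕ × ℕ

_≟c_ : DecidableEquality Cell
_≟c_ = ≡-dec _≟_ _≟_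

open import Data.List.Membership.DecPropositional _≟c_ using (_∈?_)

-- A diagram is a finite set of cells, represented by a list (order and
-- repetitions are irrelevant; diagrams are compared by their cell sets).
Diagram : Set
Diagram = List Cell

Positive : Diagram → Set
Positive D = ∀ r c → (r , c) ∈ D → (1 ≤ r) × (1 ≤ c)

_≈D_ : Diagram → Diagram → Set
A ≈D B = ∀ x → (x ∈ A → x ∈ B) × (x ∈ B → x ∈ A)

maxL : List ℕ → ℕ
maxL = foldr _⊔_ 0

rowCols : Diagram → ℕ → List ℕ
rowCols D r = map proj₂ (filter (λ x → proj₁ x ≟ r) D)

findFree : Diagram → ℕ → ℕ → Maybe ℕ
findFree D c zero = nothing
findFree D c (suc k) with (suc k , c) ∈? D
... | yes _ = findFree D c k
... | no  _ = just (suc k)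

moveCell : Diagram → Cell → Cell → Diagram
moveCell D x y = y ∷ filter (λ z → ¬? (z ≟c x)) D

K : Diagram → ℕ → Diagram
K D r with rowCols D r
... | [] = D
... | cs@(_ ∷ _) with findFree D (maxL cs) (r ∸ 1)
...   | nothing = D
...   | just r' = moveCell D (r , maxL cs) (r' , maxL cs)

Step : Diagram → Diagram → Set
Step D E = ∃ λ r → K D r ≡ E

InKD : Diagram → Diagram → Set
InKD D D~ = ∃ λ E → Star Step D E × (E ≈D D~)

InMin : Diagram → Diagram → Set
InMin D D~ = InKD D D~ × (∀ r → K D~ r ≈D D~)

-- rightmost nonempty column n of D (0 if D is empty)
numCols : Diagram → ℕ
numCols D = maxL (map proj₂ D)

maxRow : Diagram → ℕ
maxRow D = maxL (map proj₁ D)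

rows1 : ℕ → List ℕ
rows1 zero = []
rows1 (suc k) = rows1 k Data.List.++ (suc k ∷ [])

colWt : Diagram → ℕ → ℕ
colWt D i = length (filter (λ r → (r , i) ∈? D) (rows1 (maxRow D)))

maxFrom : Diagram → ℕ → ℕ → ℕ
maxFrom D j zero = 0
maxFrom D j (suc k) with j Data.Nat.≤? suc k
... | yes _ = colWt D (suc k) ⊔ maxFrom D j k
... | no  _ = 0

bigM : Diagram → ℕ → ℕ
bigM D j = maxFrom D j (numCols D)

{-# OPTIONS --safe #-}

-- A Kohnert move slides a cell down within its column, so every diagram in KD(D)
-- keeps the column weights m_c of D and stays within rows ≤ maxRow D and columns
-- ≤ n.  If K fixes row r of a diagram, the column c' of the rightmost cell of
-- row r has no free cell below it, i.e. is filled in rows 1..r; hence r ≤ m_c'.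
-- (i) A cell (r , c) with c ≥ j thus gives r ≤ m_c' ≤ M_j, as c' ≥ c.
-- (ii) If r ≤ M_j = m_i with i ≥ j, column i has a cell in some row x ≥ r, and
-- the column c' ≥ i of the rightmost cell of row x contains (r , c').
module Submission where

open import Defs
open import Data.Nat using (ℕ; zero; suc; _≤_; _<_; _+_; pred; _≟_; _≤?_; z≤n; s≤s; >-nonZero)
open import Data.Nat.Properties
open import Data.Product using (Σ; _×_; _,_; proj₁; proj₂; ∃-syntax)
open import Data.Sum using (_⊎_; inj₁; inj₂; [_,_])
open import Data.List using (List; []; _∷_; filter; length; _++_)
open import Data.List.Properties using (filter-++; length-++)
open import Data.List.Membership.Propositional using (_∈_; _∉_)
open import Data.List.Membership.Propositional.Properties
  using (∈-map⁺; ∈-filter⁺; ∈-filter⁻; ∈-map∘filter⁺; ∈-map∘filter⁻)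
open import Data.List.Relation.Unary.Any using (here; there)
open import Data.Maybe using (just; nothing)
open import Function.Base using (_∘_; case_of_)
open import Function.Bundles using (_⇔_; mk⇔; module Equivalence)
open import Function.Properties.Equivalence using () renaming (sym to ⇔-sym)
open import Level using (0ℓ)
open import Relation.Binary.PropositionalEquality
  using (_≡_; _≢_; refl; sym; trans; cong; subst; ≢-sym; module ≡-Reasoning)
open import Relation.Binary.Construct.Closure.ReflexiveTransitive using (Star; ε; _◅_)
open import Relation.Nullary using (¬_; yes; no; contradiction)
open import Relation.Nullary.Decidable using (¬?)
open import Relation.Unary using (Pred; Decidable)
open import Data.List.Membership.DecPropositional _≟c_ using (_∈?_)

open Equivalence using (to; from)

count : {P : Pred ℕ 0ℓ} → Decidable P → ℕ → ℕ
count P? zero = zero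
count P? (suc N) with P? (suc N)
... | yes _ = suc (count P? N)
... | no  _ = count P? N

module _ {P : Pred ℕ 0ℓ} (P? : Decidable P) where

  length-filter-rows1 : ∀ N → length (filter P? (rows1 N)) ≡ count P? N
  length-filter-rows1 zero = refl
  length-filter-rows1 (suc N) = begin
    length (filter P? (rows1 N ++ suc N ∷ []))
      ≡⟨ cong length (filter-++ P? (rows1 N) (suc N ∷ [])) ⟩
    length (filter P? (rows1 N) ++ filter P? (suc N ∷ []))
      ≡⟨ length-++ (filter P? (rows1 N)) ⟩
    length (filter P? (rows1 N)) + length (filter P? (suc N ∷ []))
      ≡⟨ cong (_+ length (filter P? (suc N ∷ []))) (length-filter-rows1 N) ⟩
    count P? N + length (filter P? (suc N ∷ []))
      ≡⟨ last-step ⟩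
    count P? (suc N) ∎
    where
    open ≡-Reasoning
    last-step : count P? N + length (filter P? (suc N ∷ [])) ≡ count P? (suc N)
    last-step with P? (suc N)
    ... | yes _ = +-comm (count P? N) 1
    ... | no  _ = +-identityʳ (count P? N)

  count-≤ : ∀ N → count P? N ≤ N
  count-≤ zero = z≤n
  count-≤ (suc N) with P? (suc N)
  ... | yes _ = s≤s (count-≤ N)
  ... | no  _ = m≤n⇒m≤1+n (count-≤ N)

  count-mono : ∀ {N M} → N ≤ M → count P? N ≤ count P? M
  count-mono {M = zero}  z≤n = z≤n
  count-mono {M = suc M} N≤1+M with m≤n⇒m<n∨m≡n N≤1+M
  ... | inj₂ refl = ≤-refl
  ... | inj₁ N<1+M = ≤-trans (count-mono (≤-pred N<1+M)) step
    where
    step : count P? M ≤ count P? (suc M)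
    step with P? (suc M)
    ... | yes _ = n≤1+n (count P? M)
    ... | no  _ = ≤-refl

  count-all : ∀ N → (∀ {x} → 1 ≤ x → x ≤ N → P x) → count P? N ≡ N
  count-all zero    _   = refl
  count-all (suc N) all with P? (suc N)
  ... | yes _  = cong suc (count-all N (λ 1≤x x≤N → all 1≤x (m≤n⇒m≤1+n x≤N)))
  ... | no ¬p  = contradiction (all (s≤s z≤n) ≤-refl) ¬p

  count-witness : ∀ {r} N → 1 ≤ r → r ≤ count P? N → ∃[ x ] r ≤ x × x ≤ N × P x
  count-witness zero    (s≤s _) ()
  count-witness (suc N) 1≤r r≤count with P? (suc N)
  ... | yes p = suc N , ≤-trans r≤count (s≤s (count-≤ N)) , ≤-refl , p
  ... | no  _ with count-witness N 1≤r r≤count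
  ...   | x , r≤x , x≤N , px = x , r≤x , m≤n⇒m≤1+n x≤N , px

module _ {P Q : Pred ℕ 0ℓ} (P? : Decidable P) (Q? : Decidable Q) where

  count-cong : ∀ N → (∀ {x} → x ≤ N → P x ⇔ Q x) → count P? N ≡ count Q? N
  count-cong zero    _   = refl
  count-cong (suc N) P⇔Q with count-cong N (λ x≤N → P⇔Q (m≤n⇒m≤1+n x≤N)) | P? (suc N) | Q? (suc N)
  ... | ih | yes _ | yes _ = cong suc ih
  ... | ih | no  _ | no  _ = ih
  ... | _  | yes p | no ¬q = contradiction (to (P⇔Q ≤-refl) p) ¬q
  ... | _  | no ¬p | yes q = contradiction (from (P⇔Q ≤-refl) q) ¬p

  count-insert : ∀ {a} N → ¬ P a → Q a → (∀ {x} → x ≢ a → P x ⇔ Q x) → 1 ≤ a → a ≤ N →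
                 count Q? N ≡ suc (count P? N)
  count-insert zero _ _ _ (s≤s _) ()
  count-insert {a} (suc N) ¬Pa Qa P⇔Q 1≤a a≤1+N with suc N ≟ a
  ... | yes refl with P? (suc N) | Q? (suc N)
  ...   | yes p | _     = contradiction p ¬Pa
  ...   | _     | no ¬q = contradiction Qa ¬q
  ...   | no  _ | yes _ = cong suc (sym (count-cong N (λ x≤N → P⇔Q (λ { refl → 1+n≰n x≤N }))))
  count-insert {a} (suc N) ¬Pa Qa P⇔Q 1≤a a≤1+N | no 1+N≢a
    with count-insert N ¬Pa Qa P⇔Q 1≤a (≤-pred (≤∧≢⇒< a≤1+N (≢-sym 1+N≢a)))
       | P? (suc N) | Q? (suc N)
  ... | ih | yes _ | yes _ = cong suc ih
  ... | ih | no  _ | no  _ = ih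
  ... | _  | yes p | no ¬q = contradiction (to (P⇔Q 1+N≢a) p) ¬q
  ... | _  | no ¬p | yes q = contradiction (from (P⇔Q 1+N≢a) q) ¬p

colCount : Diagram → ℕ → ℕ → ℕ
colCount E c = count (λ y → (y , c) ∈? E)

colWt≡colCount : ∀ D c → colWt D c ≡ colCount D c (maxRow D)
colWt≡colCount D c = length-filter-rows1 (λ y → (y , c) ∈? D) (maxRow D)

colCount-≈ : ∀ {E F} → E ≈D F → ∀ c N → colCount E c N ≡ colCount F c N
colCount-≈ E≈F c N = count-cong _ _ N (λ {y} _ → mk⇔ (proj₁ (E≈F (y , c))) (proj₂ (E≈F (y , c))))

∈-∷-≢ : ∀ {A : Set} {x y : A} {xs : List A} → x ≢ y → x ∈ y ∷ xs ⇔ x ∈ xs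
∈-∷-≢ x≢y = mk⇔ (λ { (here x≡y) → contradiction x≡y x≢y ; (there x∈xs) → x∈xs }) there

colCount-∷-new : ∀ {E r c} N → (r , c) ∉ E → 1 ≤ r → r ≤ N →
                 colCount ((r , c) ∷ E) c N ≡ suc (colCount E c N)
colCount-∷-new N rc∉E = count-insert _ _ N rc∉E (here refl)
  (λ y≢r → ⇔-sym (∈-∷-≢ (y≢r ∘ cong proj₁)))

colCount-∷-other : ∀ {E r c c′} N → c′ ≢ c → colCount ((r , c) ∷ E) c′ N ≡ colCount E c′ N
colCount-∷-other N c′≢c = count-cong _ _ N (λ _ → ∈-∷-≢ (c′≢c ∘ cong proj₂))

removeCell : Diagram → Cell → Diagram
removeCell E x = filter (λ z → ¬? (z ≟c x)) E

∈-removeCell⁻ : ∀ {E x z} → z ∈ removeCell E x → z ∈ E × z ≢ x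
∈-removeCell⁻ {E} {x} = ∈-filter⁻ (λ z → ¬? (z ≟c x)) {xs = E}

∈-removeCell⁺ : ∀ {E x z} → z ∈ E → z ≢ x → z ∈ removeCell E x
∈-removeCell⁺ {E} {x} = ∈-filter⁺ (λ z → ¬? (z ≟c x))

∈-moveCell⁻ : ∀ {E x y z} → z ∈ moveCell E x y → z ≡ y ⊎ z ∈ E
∈-moveCell⁻ (here z≡y)    = inj₁ z≡y
∈-moveCell⁻ (there z∈E⁻) = inj₂ (proj₁ (∈-removeCell⁻ z∈E⁻))

∷-removeCell-≈ : ∀ {E x} → x ∈ E → (x ∷ removeCell E x) ≈D E
∷-removeCell-≈ {E} {x} x∈E z = into , out
  where
  into : z ∈ x ∷ removeCell E x → z ∈ E
  into (here refl) = x∈E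
  into (there z∈E⁻) = proj₁ (∈-removeCell⁻ z∈E⁻)
  out : z ∈ E → z ∈ x ∷ removeCell E x
  out z∈E with z ≟c x
  ... | yes refl = here refl
  ... | no z≢x   = there (∈-removeCell⁺ z∈E z≢x)

colCount-removeCell-other : ∀ {E r c c′} N → c′ ≢ c →
                            colCount (removeCell E (r , c)) c′ N ≡ colCount E c′ N
colCount-removeCell-other N c′≢c = count-cong _ _ N (λ _ →
  mk⇔ (proj₁ ∘ ∈-removeCell⁻) (λ y∈E → ∈-removeCell⁺ y∈E (c′≢c ∘ cong proj₂)))

colCount-moveCell : ∀ {E r r′ c} N → (r , c) ∈ E → (r′ , c) ∉ E →
                    1 ≤ r → r ≤ N → 1 ≤ r′ → r′ ≤ N →
                    ∀ c′ → colCount (moveCell E (r , c) (r′ , c)) c′ N ≡ colCount E c′ N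
colCount-moveCell {E} {r} {r′} {c} N rc∈E r′c∉E 1≤r r≤N 1≤r′ r′≤N c′ with c′ ≟ c
... | yes refl = begin
  colCount ((r′ , c) ∷ E⁻) c N  ≡⟨ colCount-∷-new N r′c∉E⁻ 1≤r′ r′≤N ⟩
  suc (colCount E⁻ c N)          ≡⟨ colCount-∷-new N rc∉E⁻ 1≤r r≤N ⟨
  colCount ((r , c) ∷ E⁻) c N    ≡⟨ colCount-≈ (∷-removeCell-≈ rc∈E) c N ⟩
  colCount E c N                 ∎
  where
  open ≡-Reasoning
  E⁻ = removeCell E (r , c)
  r′c∉E⁻ : (r′ , c) ∉ E⁻
  r′c∉E⁻ = r′c∉E ∘ proj₁ ∘ ∈-removeCell⁻ {E}
  rc∉E⁻ : (r , c) ∉ E⁻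
  rc∉E⁻ rc∈E⁻ = proj₂ (∈-removeCell⁻ {E} rc∈E⁻) refl
... | no c′≢c = trans (colCount-∷-other N c′≢c) (colCount-removeCell-other N c′≢c)

maxL-upper : ∀ {x xs} → x ∈ xs → x ≤ maxL xs
maxL-upper {xs = y ∷ ys} (here refl) = m≤m⊔n y (maxL ys)
maxL-upper {xs = y ∷ ys} (there x∈ys) = ≤-trans (maxL-upper x∈ys) (m≤n⊔m y (maxL ys))

maxL-∈ : ∀ {x xs} → x ∈ xs → maxL xs ∈ xs
maxL-∈ {xs = y ∷ ys} _ = maxL-∷-∈ y ys
  where
  maxL-∷-∈ : ∀ y ys → maxL (y ∷ ys) ∈ y ∷ ys
  maxL-∷-∈ y [] = here (⊔-identityʳ y)
  maxL-∷-∈ y (z ∷ zs) with ≤-total y (maxL (z ∷ zs))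
  ... | inj₁ y≤m = subst (_∈ y ∷ z ∷ zs) (sym (m≤n⇒m⊔n≡n y≤m)) (there (maxL-∷-∈ z zs))
  ... | inj₂ m≤y = subst (_∈ y ∷ z ∷ zs) (sym (m≥n⇒m⊔n≡m m≤y)) (here refl)

∈-rowCols⁺ : ∀ {E r c} → (r , c) ∈ E → c ∈ rowCols E r
∈-rowCols⁺ {r = r} rc∈E = ∈-map∘filter⁺ proj₂ (λ (x : Cell) → proj₁ x ≟ r) (_ , rc∈E , refl , refl)

∈-rowCols⁻ : ∀ {E r c} → c ∈ rowCols E r → (r , c) ∈ E
∈-rowCols⁻ {E} {r} c∈ with ∈-map∘filter⁻ proj₂ (λ (x : Cell) → proj₁ x ≟ r) {xs = E} c∈
... | _ , x∈E , refl , refl = x∈E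

rightmost : Diagram → ℕ → ℕ
rightmost E r = maxL (rowCols E r)

≤-rightmost : ∀ {E r c} → (r , c) ∈ E → c ≤ rightmost E r
≤-rightmost rc∈E = maxL-upper (∈-rowCols⁺ rc∈E)

rightmost-∈ : ∀ {E r c} → (r , c) ∈ E → (r , rightmost E r) ∈ E
rightmost-∈ rc∈E = ∈-rowCols⁻ (maxL-∈ (∈-rowCols⁺ rc∈E))

findFree-just : ∀ {E c r′} k → findFree E c k ≡ just r′ → 1 ≤ r′ × r′ ≤ k × (r′ , c) ∉ E
findFree-just {E} {c} (suc k) eq with (suc k , c) ∈? E | eq
... | no  k+1∉E | refl = s≤s z≤n , ≤-refl , k+1∉E
... | yes _     | eq′ with findFree-just k eq′
...   | 1≤r′ , r′≤k , r′∉E = 1≤r′ , m≤n⇒m≤1+n r′≤k , r′∉E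

findFree-nothing : ∀ {E c y} k → findFree E c k ≡ nothing → 1 ≤ y → y ≤ k → (y , c) ∈ E
findFree-nothing zero _ (s≤s _) ()
findFree-nothing {E} {c} {y} (suc k) eq 1≤y y≤1+k with (suc k , c) ∈? E | eq
... | no  _      | ()
... | yes k+1∈E  | eq′ with m≤n⇒m<n∨m≡n y≤1+k
...   | inj₂ refl = k+1∈E
...   | inj₁ y<1+k = findFree-nothing k eq′ 1≤y (≤-pred y<1+k)

data KohnertMove (E : Diagram) (r : ℕ) : Diagram → Set where
  empty-row : (∀ {c} → (r , c) ∉ E) → KohnertMove E r E
  blocked   : (∀ {y} → 1 ≤ y → y < r → (y , rightmost E r) ∈ E) → KohnertMove E r E
  slide     : ∀ {c r′} → (r , c) ∈ E → 1 ≤ r′ → r′ < r → (r′ , c) ∉ E →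
              KohnertMove E r (moveCell E (r , c) (r′ , c))

kohnertMove : ∀ E r → KohnertMove E r (K E r)
kohnertMove E r with rowCols E r in row
... | [] = empty-row (λ rc∈E → case subst (_ ∈_) row (∈-rowCols⁺ rc∈E) of λ ())
... | c ∷ cs with findFree E (maxL (c ∷ cs)) (pred r) in free
...   | nothing = blocked (λ 1≤y y<r → subst (λ m → (_ , m) ∈ E) (cong maxL (sym row))
                                          (findFree-nothing (pred r) free 1≤y (<⇒≤pred y<r)))
...   | just r′ with findFree-just (pred r) free
...     | 1≤r′ , r′≤pred[r] , r′∉E = slide rc∈E 1≤r′ r′<r r′∉E
  where
  rc∈E : (r , maxL (c ∷ cs)) ∈ E
  rc∈E = ∈-rowCols⁻ (subst (_ ∈_) (sym row) (maxL-∈ (here refl)))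
  r′<r : r′ < r
  r′<r = m≤pred[n]⇒suc[m]≤n {{>-nonZero (≤-trans 1≤r′ (≤pred⇒≤ r′≤pred[r]))}} r′≤pred[r]

column-full-below-rightmost : ∀ {E r c y} → K E r ≈D E → (r , c) ∈ E → 1 ≤ y → y ≤ r →
                              (y , rightmost E r) ∈ E
column-full-below-rightmost {E} {r} fixed rc∈E = from-move (kohnertMove E r) fixed
  where
  from-move : ∀ {F y} → KohnertMove E r F → F ≈D E → 1 ≤ y → y ≤ r → (y , rightmost E r) ∈ E
  from-move (empty-row row-empty)  _     _   _   = contradiction rc∈E row-empty
  from-move (blocked full)         _     1≤y y≤r with m≤n⇒m<n∨m≡n y≤r
  ... | inj₁ y<r  = full 1≤y y<r
  ... | inj₂ refl = rightmost-∈ rc∈E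
  from-move (slide _ _ _ r′c∉E)    F≈E   _   _   = contradiction (proj₁ (F≈E _) (here refl)) r′c∉E

record Boxed (B n : ℕ) (wt : ℕ → ℕ) (E : Diagram) : Set where
  field
    row≤      : ∀ {r c} → (r , c) ∈ E → r ≤ B
    col≤      : ∀ {r c} → (r , c) ∈ E → c ≤ n
    colCount≡ : ∀ c → colCount E c B ≡ wt c

open Boxed

module _ {B n : ℕ} {wt : ℕ → ℕ} where

  Boxed-≈ : ∀ {E F} → Boxed B n wt E → E ≈D F → Boxed B n wt F
  Boxed-≈ bx E≈F = record
    { row≤      = row≤ bx ∘ proj₂ (E≈F _)
    ; col≤      = col≤ bx ∘ proj₂ (E≈F _)
    ; colCount≡ = λ c → trans (sym (colCount-≈ E≈F c B)) (colCount≡ bx c)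
    }

  Boxed-move : ∀ {E r F} → Boxed B n wt E → KohnertMove E r F → Boxed B n wt F
  Boxed-move bx (empty-row _) = bx
  Boxed-move bx (blocked _)   = bx
  Boxed-move bx (slide {r′ = r′} rc∈E 1≤r′ r′<r r′c∉E) = record
    { row≤      = λ x∈F → [ (λ { refl → r′≤B }) , row≤ bx ] (∈-moveCell⁻ x∈F)
    ; col≤      = λ x∈F → [ (λ { refl → col≤ bx rc∈E }) , col≤ bx ] (∈-moveCell⁻ x∈F)
    ; colCount≡ = λ c′ → trans (colCount-moveCell B rc∈E r′c∉E 1≤r r≤B 1≤r′ r′≤B c′) (colCount≡ bx c′)
    }
    where
    r≤B = row≤ bx rc∈E
    1≤r = ≤-trans 1≤r′ (<⇒≤ r′<r)
    r′≤B = ≤-trans (<⇒≤ r′<r) r≤B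

  Boxed-KD : ∀ {E F} → Boxed B n wt E → Star Step E F → Boxed B n wt F
  Boxed-KD bx ε                = bx
  Boxed-KD bx ((r , refl) ◅ E↝F) = Boxed-KD (Boxed-move bx (kohnertMove _ r)) E↝F

Boxed-initial : ∀ D → Boxed (maxRow D) (numCols D) (colWt D) D
Boxed-initial D = record
  { row≤      = maxL-upper ∘ ∈-map⁺ proj₁
  ; col≤      = maxL-upper ∘ ∈-map⁺ proj₂
  ; colCount≡ = λ c → sym (colWt≡colCount D c)
  }

module _ {B n : ℕ} {wt : ℕ → ℕ} {E : Diagram} (bx : Boxed B n wt E) where

  row≤wt[rightmost] : ∀ {r c} → K E r ≈D E → (r , c) ∈ E → r ≤ wt (rightmost E r)
  row≤wt[rightmost] {r} fixed rc∈E = begin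
    r                               ≡⟨ count-all _ r (column-full-below-rightmost fixed rc∈E) ⟨
    colCount E (rightmost E r) r    ≤⟨ count-mono _ (row≤ bx rc∈E) ⟩
    colCount E (rightmost E r) B    ≡⟨ colCount≡ bx (rightmost E r) ⟩
    wt (rightmost E r)              ∎
    where open ≤-Reasoning

  row-occupied-right-of : ∀ {r i} → (∀ x → K E x ≈D E) → 1 ≤ r → r ≤ wt i →
                          ∃[ c ] i ≤ c × c ≤ n × (r , c) ∈ E
  row-occupied-right-of {r} {i} fixed 1≤r r≤wt
    with count-witness _ B 1≤r (subst (r ≤_) (sym (colCount≡ bx i)) r≤wt)
  ... | x , r≤x , _ , xi∈E =
    rightmost E x , ≤-rightmost xi∈E , col≤ bx rc∈E , rc∈E
    where
    rc∈E : (r , rightmost E x) ∈ E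
    rc∈E = column-full-below-rightmost (fixed x) xi∈E 1≤r r≤x

colWt≤maxFrom : ∀ D {j c} k → 1 ≤ j → j ≤ c → c ≤ k → colWt D c ≤ maxFrom D j k
colWt≤maxFrom D zero 1≤j j≤c c≤0 = contradiction (≤-trans 1≤j (≤-trans j≤c c≤0)) λ ()
colWt≤maxFrom D {j} (suc k) 1≤j j≤c c≤1+k with j ≤? suc k
... | no  j≰1+k = contradiction (≤-trans j≤c c≤1+k) j≰1+k
... | yes _ with m≤n⇒m<n∨m≡n c≤1+k
...   | inj₂ refl  = m≤m⊔n _ _
...   | inj₁ c<1+k = ≤-trans (colWt≤maxFrom D k 1≤j j≤c (≤-pred c<1+k)) (m≤n⊔m _ _)

maxFrom-attained : ∀ D {j r} k → 1 ≤ r → r ≤ maxFrom D j k → ∃[ i ] j ≤ i × i ≤ k × r ≤ colWt D i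
maxFrom-attained D zero (s≤s _) ()
maxFrom-attained D {j} {r} (suc k) 1≤r r≤max with j ≤? suc k
... | no  _ = contradiction (≤-trans 1≤r r≤max) λ ()
... | yes j≤1+k with ≤-total (colWt D (suc k)) (maxFrom D j k)
...   | inj₂ w≥m = suc k , j≤1+k , ≤-refl , subst (r ≤_) (m≥n⇒m⊔n≡m w≥m) r≤max
...   | inj₁ w≤m with maxFrom-attained D k 1≤r (subst (r ≤_) (m≤n⇒m⊔n≡n w≤m) r≤max)
...     | i , j≤i , i≤k , r≤wt = i , j≤i , m≤n⇒m≤1+n i≤k , r≤wt

lemma4p2 : (D : Diagram) → Positive D →
    (D~ : Diagram) → InMin D D~ →
    (j : ℕ) → 1 ≤ j → j ≤ numCols D →
    ((r c : ℕ) → (r , c) ∈ D~ → j ≤ c → c ≤ numCols D → r ≤ bigM D j)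
    × ((r~ : ℕ) → 1 ≤ r~ → r~ ≤ bigM D j →
       Σ ℕ (λ c → (j ≤ c) × (c ≤ numCols D) × ((r~ , c) ∈ D~)))
lemma4p2 D _ D~ ((E , D↝E , E≈D~) , fixed) j 1≤j _ = rows-bounded , rows-occupied
  where
  bx : Boxed (maxRow D) (numCols D) (colWt D) D~
  bx = Boxed-≈ (Boxed-KD (Boxed-initial D) D↝E) E≈D~

  rows-bounded : (r c : ℕ) → (r , c) ∈ D~ → j ≤ c → c ≤ numCols D → r ≤ bigM D j
  rows-bounded r c rc∈D~ j≤c _ = ≤-trans (row≤wt[rightmost] bx (fixed r) rc∈D~)
    (colWt≤maxFrom D (numCols D) 1≤j (≤-trans j≤c (≤-rightmost rc∈D~)) (col≤ bx (rightmost-∈ rc∈D~)))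

  rows-occupied : (r : ℕ) → 1 ≤ r → r ≤ bigM D j →
                  Σ ℕ (λ c → (j ≤ c) × (c ≤ numCols D) × ((r , c) ∈ D~))
  rows-occupied r 1≤r r≤M with maxFrom-attained D (numCols D) 1≤r r≤M
  ... | i , j≤i , _ , r≤wt with row-occupied-right-of bx fixed 1≤r r≤wt
  ...   | c , i≤c , c≤n , rc∈D~ = c , ≤-trans j≤i i≤c , c≤n , rc∈D~
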